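{- Let $P$ be a finite sequence of nonnegative integers. Then the following are equivalent: (i) $P$ is loop graphic; (ii) the pair $(P,P)$ is bigraphic; (iii) $P$ is mirror bigraphic.
   Context: An $l$-graph is a graph without multiple edges in which each vertex has at most one loop attached. In an $l$-graph the degree of a vertex is the number of edges incident with it, where a loop contributes exactly $1$ to the degree. A sequence $P$ of nonnegative integers is loop graphic if there is an $l$-graph whose multiset of vertex degrees equals the multiset of entries of $P$. A bipartite graph is written $G=(V_1\cup V_2,E)$ with stable sets (parts) $V_1,V_2$. For finite sequences $P,Q$ of nonnegative integers, the pair $(P,Q)$ is bigraphic if there is a simple bipartite graph $G=(V_1\cup V_2,E)$ such that the multiset of degrees of vertices in $V_1$ equals the multiset of entries of $P$ and that of $V_2$ equals the multiset of entries of $Q$; $G$ is then said to realize $(P,Q)$. A mirror bipartite graph is a bipartite graph $G=(V_1\cup V_2,E)$ for which there is a bijection $\varphi:V_1\to V_2$ such that for all $u,v\in V_1$, $u\varphi(v)\in E$ if and only if $\varphi(u)v\in E$. $P$ is mirror bigraphic if some mirror bipartite graph realizes $(P,P)$. -}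

module Defs where

open import Data.Nat using (ℕ)
open import Data.Bool using (Bool; true; false; if_then_else_)
open import Data.Fin using (Fin)
open import Data.List using (List; map; length; allFin)
open import Data.Nat.ListAction using (sum)
open import Data.Product using (Σ; ∃; _×_)
open import Data.List.Relation.Binary.Permutation.Propositional using (_↭_)
open import Relation.Binary.PropositionalEquality using (_≡_)
open import Function.Bundles using (_↔_; Inverse)

[_] : Bool → ℕ
[ b ] = if b then 1 else 0

count : {n : ℕ} → (Fin n → Bool) → ℕ
count {n} f = sum (map (λ x → [ f x ]) (allFin n))

-- An l-graph on vertex set Fin n: a symmetric adjacency relation E.
-- E v v = true means v carries a (single) loop; for u ≢ v, E u v = true
-- means there is the (single) edge uv. Hence no multiple edges and at most
-- one loop per vertex.
record LGraph (n : ℕ) : Set where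
  field
    adj : Fin n → Fin n → Bool
    sym : ∀ u v → adj u v ≡ adj v u

-- degree in an l-graph: each neighbour u ≢ v contributes 1, a loop contributes 1
lDegree : {n : ℕ} → LGraph n → Fin n → ℕ
lDegree G v = count (λ u → LGraph.adj G v u)

lDegSeq : {n : ℕ} → LGraph n → List ℕ
lDegSeq {n} G = map (lDegree G) (allFin n)

LoopGraphic : List ℕ → Set
LoopGraphic P = Σ ℕ λ n → Σ (LGraph n) λ G → lDegSeq G ↭ P

BiGraph : ℕ → ℕ → Set
BiGraph m k = Fin m → Fin k → Bool

degSeq₁ : {m k : ℕ} → BiGraph m k → List ℕ
degSeq₁ {m} {k} B = map (λ u → count (λ w → B u w)) (allFin m)

degSeq₂ : {m k : ℕ} → BiGraph m k → List ℕ
degSeq₂ {m} {k} B = map (λ w → count (λ u → B u w)) (allFin k)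

Realizes : {m k : ℕ} → BiGraph m k → List ℕ → List ℕ → Set
Realizes B P Q = (degSeq₁ B ↭ P) × (degSeq₂ B ↭ Q)

Bigraphic : List ℕ → List ℕ → Set
Bigraphic P Q = Σ ℕ λ m → Σ ℕ λ k → Σ (BiGraph m k) λ B → Realizes B P Q

IsMirror : {m k : ℕ} → BiGraph m k → Set
IsMirror {m} {k} B =
  Σ (Fin m ↔ Fin k) λ φ →
    ∀ u v → B u (Inverse.to φ v) ≡ B v (Inverse.to φ u)

MirrorBigraphic : List ℕ → Set
MirrorBigraphic P =
  Σ ℕ λ m → Σ ℕ λ k → Σ (BiGraph m k) λ B → IsMirror B × Realizes B P P

-- An l-graph is the same thing as a symmetric 0-1 matrix (the diagonal holds
-- the loops), and a bipartite graph realizing (P , P) is, after matching each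
-- vertex of V₁ with a vertex of V₂ of equal degree, a 0-1 matrix whose u-th row
-- and u-th column have the same sum.  Such a matrix can be made symmetric
-- without changing any line sum: while row w and column w disagree, a 2-switch
-- (exchanging the 1s and 0s of a 2×2 submatrix [[1,0],[0,1]]) removes two of
-- the disagreements at w, and once row and column w agree, w can be set aside.
module Submission where

open import Defs
open import Data.Nat using (ℕ; zero; suc; _+_; _≤_; _<_; z≤n; s≤s)
open import Data.Nat.ListAction using (sum)
open import Data.Nat.Properties
  using (≤-refl; ≤-reflexive; ≤-total; <⇒≱; +-mono-≤; +-mono-≤-<; +-cancelˡ-≡)
  using (+-0-commutativeMonoid)
open import Data.Nat.Induction using (<-wellFounded)
open import Data.Bool using (Bool; true; false; _∨_; _xor_; if_then_else_)
open import Data.Bool.Properties using () renaming (_≟_ to _≟ᵇ_)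
open import Data.Fin using (Fin; zero; suc)
open import Data.Fin.Properties using (_≟_; any?; all?; ¬∀⟶∃¬)
import Data.Fin.Permutation.Components as PC
open import Data.Fin.Permutation as Perm using (Permutation; _⟨$⟩ʳ_; _∘ₚ_)
open import Data.List using (List; map; allFin; tabulate; lookup; length)
open import Data.List.Properties using (map-cong; map-tabulate; length-tabulate; lookup-tabulate)
open import Data.List.Relation.Binary.Permutation.Propositional
  using (_↭_; ↭-trans; ↭-sym; ↭-reflexive; ↭⇒↭ₛ)
import Data.List.Relation.Binary.Permutation.Setoid as SetoidPermutation
import Data.List.Relation.Binary.Permutation.Setoid.Properties as SetoidPermutationProperties
import Algebra.Properties.CommutativeMonoid.Sum as CommutativeMonoidSum
open import Data.Product using (Σ; ∃; _×_; _,_; proj₁; swap)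
open import Data.Sum using (_⊎_; inj₁; inj₂)
open import Function using (id; _∘_)
open import Function.Bundles using (_⇔_; mk⇔)
open import Function.Construct.Identity using (↔-id)
open import Induction.WellFounded using (Acc; acc)
open import Relation.Nullary using (Dec; yes; no; does; contradiction; _×-dec_)
open import Relation.Nullary.Decidable using (dec-true; dec-false)
open import Relation.Binary.PropositionalEquality
  using (_≡_; _≢_; refl; sym; trans; cong; cong₂; subst₂; _≗_; setoid; module ≡-Reasoning)

open ≡-Reasoning

private
  variable
    n : ℕ

module ∑ = CommutativeMonoidSum +-0-commutativeMonoid

_⊆_ : (f g : Fin n → Bool) → Set
f ⊆ g = ∀ x → f x ≡ true → g x ≡ true

count-suc : (f : Fin (suc n) → Bool) → count f ≡ [ f zero ] + count (λ x → f (suc x))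
count-suc {n} f = cong ([ f zero ] +_) (cong sum (begin
  map (λ x → [ f x ]) (tabulate suc)     ≡⟨ map-tabulate suc _ ⟩
  tabulate (λ x → [ f (suc x) ])         ≡⟨ map-tabulate id _ ⟨
  map (λ x → [ f (suc x) ]) (allFin n)   ∎))

count≡∑ : (f : Fin n → Bool) → count f ≡ ∑.sum (λ x → [ f x ])
count≡∑ {zero}  f = refl
count≡∑ {suc n} f = trans (count-suc f) (cong ([ f zero ] +_) (count≡∑ (λ x → f (suc x))))

count-cong : {f g : Fin n → Bool} → f ≗ g → count f ≡ count g
count-cong {n} f≗g = cong sum (map-cong (λ x → cong [_] (f≗g x)) (allFin n))

count-permute : ∀ {m} (π : Permutation m n) (f : Fin n → Bool) →
  count (λ x → f (π ⟨$⟩ʳ x)) ≡ count f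
count-permute π f = begin
  count (λ x → f (π ⟨$⟩ʳ x))       ≡⟨ count≡∑ (λ x → f (π ⟨$⟩ʳ x)) ⟩
  ∑.sum (λ x → [ f (π ⟨$⟩ʳ x) ])   ≡⟨ ∑.sum-permute (λ x → [ f x ]) π ⟨
  ∑.sum (λ x → [ f x ])            ≡⟨ count≡∑ f ⟨
  count f                          ∎

[]-mono : {b c : Bool} → (b ≡ true → c ≡ true) → [ b ] ≤ [ c ]
[]-mono {false} _ = z≤n
[]-mono {true}  b⇒c rewrite b⇒c refl = ≤-refl

count-mono-≤ : {f g : Fin n → Bool} → f ⊆ g → count f ≤ count g
count-mono-≤ {zero}          _   = z≤n
count-mono-≤ {suc n} {f} {g} f⊆g = subst₂ _≤_ (sym (count-suc f)) (sym (count-suc g))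
  (+-mono-≤ ([]-mono (f⊆g zero)) (count-mono-≤ (λ x → f⊆g (suc x))))

count-mono-< : {f g : Fin n → Bool} {z : Fin n} →
  f ⊆ g → g z ≡ true → f z ≡ false → count f < count g
count-mono-< {suc n} {f} {g} {z} f⊆g gz fz =
  subst₂ _<_ (sym (count-suc f)) (sym (count-suc g)) (head+tail z gz fz)
  where
  head+tail : ∀ z → g z ≡ true → f z ≡ false →
    [ f zero ] + count (λ x → f (suc x)) < [ g zero ] + count (λ x → g (suc x))
  head+tail zero    gz fz rewrite gz | fz = s≤s (count-mono-≤ (λ x → f⊆g (suc x)))
  head+tail (suc z) gz fz =
    +-mono-≤-< ([]-mono (f⊆g zero)) (count-mono-< (λ x → f⊆g (suc x)) gz fz)

count-surplus : (f g : Fin n → Bool) {z : Fin n} →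
  count g ≤ count f → g z ≡ true → f z ≡ false → ∃ λ c → f c ≡ true × g c ≡ false
count-surplus f g g≤f gz fz with any? (λ c → (f c ≟ᵇ true) ×-dec (g c ≟ᵇ false))
... | yes surplus = surplus
... | no ¬surplus = contradiction g≤f (<⇒≱ (count-mono-< f⊆g gz fz))
  where
  f⊆g : f ⊆ g
  f⊆g c fc with g c in gc
  ... | true  = refl
  ... | false = contradiction (c , fc , gc) ¬surplus

-- Square 0-1 matrices and their line sums

Mat : ℕ → Set
Mat n = Fin n → Fin n → Bool

_ᵀ : Mat n → Mat n
(A ᵀ) u v = A v u

rowSum : Mat n → Fin n → ℕ
rowSum A u = count (A u)

colSum : Mat n → Fin n → ℕ
colSum A v = count (λ u → A u v)

Balanced : Mat n → Set
Balanced A = ∀ u → rowSum A u ≡ colSum A u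

Symmetric : Mat n → Set
Symmetric A = ∀ u v → A u v ≡ A v u

SymmetricAt : Mat n → Fin n → Set
SymmetricAt A w = ∀ v → A w v ≡ A v w

SameSums : Mat n → Mat n → Set
SameSums S A = rowSum S ≗ rowSum A × colSum S ≗ colSum A

sameSums-refl : {A : Mat n} → SameSums A A
sameSums-refl = (λ _ → refl) , (λ _ → refl)

sameSums-trans : {A B C : Mat n} → SameSums A B → SameSums B C → SameSums A C
sameSums-trans (r₁ , c₁) (r₂ , c₂) = (λ u → trans (r₁ u) (r₂ u)) , (λ v → trans (c₁ v) (c₂ v))

sameSums-ᵀ : {S A : Mat n} → SameSums S (A ᵀ) → SameSums (S ᵀ) A
sameSums-ᵀ = swap

balanced-ᵀ : {A : Mat n} → Balanced A → Balanced (A ᵀ)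
balanced-ᵀ bal u = sym (bal u)

balanced-sameSums : {S A : Mat n} → SameSums S A → Balanced A → Balanced S
balanced-sameSums (rows , cols) bal u = trans (rows u) (trans (bal u) (sym (cols u)))

-- 2-switches

transpose-matchˡ : (i j : Fin n) → PC.transpose i j i ≡ j
transpose-matchˡ i j rewrite dec-true (i ≟ i) refl = refl

transpose-matchʳ : (i j : Fin n) → PC.transpose i j j ≡ i
transpose-matchʳ i j with j ≟ i
... | yes j≡i = j≡i
... | no  _   rewrite dec-true (j ≟ j) refl = refl

transpose-other : {i j k : Fin n} → k ≢ i → k ≢ j → PC.transpose i j k ≡ k
transpose-other {i = i} {j} {k} k≢i k≢j
  rewrite dec-false (k ≟ i) k≢i | dec-false (k ≟ j) k≢j = refl

switch : Mat n → (i i' j j' : Fin n) → Mat n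
switch A i i' j j' u v = if does (u ≟ i) ∨ does (u ≟ i') then A u (PC.transpose j j' v) else A u v

module _ (A : Mat n) (i i' j j' : Fin n) where

  switch-inside : ∀ {u} v → u ≡ i ⊎ u ≡ i' → switch A i i' j j' u v ≡ A u (PC.transpose j j' v)
  switch-inside {u} v (inj₁ refl) rewrite dec-true (u ≟ u) refl = refl
  switch-inside {u} v (inj₂ refl) rewrite dec-true (u ≟ u) refl with does (u ≟ i)
  ... | true  = refl
  ... | false = refl

  switch-outside : ∀ {u} v → u ≢ i → u ≢ i' → switch A i i' j j' u v ≡ A u v
  switch-outside {u} v u≢i u≢i' rewrite dec-false (u ≟ i) u≢i | dec-false (u ≟ i') u≢i' = refl

  switch-fixedColumn : ∀ u {v} → PC.transpose j j' v ≡ v → switch A i i' j j' u v ≡ A u v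
  switch-fixedColumn u τv≡v with does (u ≟ i) ∨ does (u ≟ i')
  ... | true  = cong (A u) τv≡v
  ... | false = refl

  switch-rowSum : ∀ u → rowSum (switch A i i' j j') u ≡ rowSum A u
  switch-rowSum u with does (u ≟ i) ∨ does (u ≟ i')
  ... | true  = count-permute (Perm.transpose j j') (A u)
  ... | false = refl

  module _ (ij : A i j ≡ true) (i'j' : A i' j' ≡ true) (ij' : A i j' ≡ false) (i'j : A i' j ≡ false) where

    crossedˡ : ∀ {v} → v ≡ j ⊎ v ≡ j' → A i (PC.transpose j j' v) ≡ A i' v
    crossedˡ (inj₁ refl) = trans (cong (A i) (transpose-matchˡ j j')) (trans ij' (sym i'j))
    crossedˡ (inj₂ refl) = trans (cong (A i) (transpose-matchʳ j j')) (trans ij (sym i'j'))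

    crossedʳ : ∀ {v} → v ≡ j ⊎ v ≡ j' → A i' (PC.transpose j j' v) ≡ A i v
    crossedʳ (inj₁ refl) = trans (cong (A i') (transpose-matchˡ j j')) (trans i'j' (sym ij))
    crossedʳ (inj₂ refl) = trans (cong (A i') (transpose-matchʳ j j')) (trans i'j (sym ij'))

    switch-column : ∀ {v} → v ≡ j ⊎ v ≡ j' → ∀ u →
      switch A i i' j j' u v ≡ A (PC.transpose i i' u) v
    switch-column {v} v∈ u = byRow (u ≟ i) (u ≟ i')
      where
      byRow : Dec (u ≡ i) → Dec (u ≡ i') → switch A i i' j j' u v ≡ A (PC.transpose i i' u) v
      byRow (yes refl) _ = begin
        switch A u i' j j' u v            ≡⟨ switch-inside v (inj₁ refl) ⟩
        A u (PC.transpose j j' v)         ≡⟨ crossedˡ v∈ ⟩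
        A i' v                            ≡⟨ cong (λ x → A x v) (transpose-matchˡ u i') ⟨
        A (PC.transpose u i' u) v         ∎
      byRow (no _) (yes refl) = begin
        switch A i u j j' u v             ≡⟨ switch-inside v (inj₂ refl) ⟩
        A u (PC.transpose j j' v)         ≡⟨ crossedʳ v∈ ⟩
        A i v                             ≡⟨ cong (λ x → A x v) (transpose-matchʳ i u) ⟨
        A (PC.transpose i u u) v          ∎
      byRow (no u≢i) (no u≢i') =
        trans (switch-outside v u≢i u≢i') (cong (λ x → A x v) (sym (transpose-other u≢i u≢i')))

    crossedColumn-colSum : ∀ {v} → v ≡ j ⊎ v ≡ j' → colSum (switch A i i' j j') v ≡ colSum A v
    crossedColumn-colSum {v} v∈ =
      trans (count-cong (switch-column v∈)) (count-permute (Perm.transpose i i') (λ u → A u v))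

    switch-colSum : ∀ v → colSum (switch A i i' j j') v ≡ colSum A v
    switch-colSum v = byColumn (v ≟ j) (v ≟ j')
      where
      byColumn : Dec (v ≡ j) → Dec (v ≡ j') → colSum (switch A i i' j j') v ≡ colSum A v
      byColumn (yes v≡j) _         = crossedColumn-colSum (inj₁ v≡j)
      byColumn (no _)   (yes v≡j') = crossedColumn-colSum (inj₂ v≡j')
      byColumn (no v≢j) (no v≢j')  = count-cong (λ u → switch-fixedColumn u (transpose-other v≢j v≢j'))

    switch-sameSums : SameSums (switch A i i' j j') A
    switch-sameSums = switch-rowSum , switch-colSum

xor-comm : ∀ x y → x xor y ≡ y xor x
xor-comm false false = refl
xor-comm false true  = refl
xor-comm true  false = refl
xor-comm true  true  = refl

mismatch : Mat n → Fin n → ℕ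
mismatch A w = count (λ v → A w v xor A v w)

mismatch-ᵀ : (A : Mat n) (w : Fin n) → mismatch (A ᵀ) w ≡ mismatch A w
mismatch-ᵀ A w = count-cong (λ v → xor-comm (A v w) (A w v))

LessAsymmetricAt : Mat n → Fin n → Set
LessAsymmetricAt A w = Σ (Mat _) λ S → SameSums S A × mismatch S w < mismatch A w

lessAsymmetricAt-ᵀ : {A : Mat n} {w : Fin n} → LessAsymmetricAt (A ᵀ) w → LessAsymmetricAt A w
lessAsymmetricAt-ᵀ {A = A} {w} (S , same , lt) =
  S ᵀ , sameSums-ᵀ same , subst₂ _<_ (sym (mismatch-ᵀ S w)) (mismatch-ᵀ A w) lt

-- Rows b, a and columns w, c carry the pattern [[1,0],[0,1]]; switching it repairs
-- the disagreements at a and b and changes no other entry of row w or column w.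
switch-lessAsymmetricAt : (A : Mat n) {w a b c : Fin n} →
  A w a ≡ true → A a w ≡ false → A b w ≡ true → A w b ≡ false → A a c ≡ true → A b c ≡ false →
  LessAsymmetricAt A w
switch-lessAsymmetricAt A {w} {a} {b} {c} wa aw bw wb ac bc =
  S , switch-sameSums A b a w c bw ac bc aw , count-mono-< shrinks (cong₂ _xor_ wa aw) mismatchS-a
  where
  S : Mat _
  S = switch A b a w c

  w≢a : w ≢ a
  w≢a refl = contradiction (trans (sym wa) aw) (λ ())

  w≢b : w ≢ b
  w≢b refl = contradiction (trans (sym bw) wb) (λ ())

  rowW : ∀ v → S w v ≡ A w v
  rowW v = switch-outside A b a w c v w≢b w≢a

  mismatchS-a : S w a xor S a w ≡ false
  mismatchS-a = cong₂ _xor_ (trans (rowW a) wa)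
    (trans (switch-inside A b a w c w (inj₂ refl)) (trans (cong (A a) (transpose-matchˡ w c)) ac))

  shrinks : (λ v → S w v xor S v w) ⊆ (λ v → A w v xor A v w)
  shrinks v = byVertex (v ≟ a) (v ≟ b)
    where
    byVertex : Dec (v ≡ a) → Dec (v ≡ b) → S w v xor S v w ≡ true → A w v xor A v w ≡ true
    byVertex (yes refl) _          h = contradiction (trans (sym h) mismatchS-a) (λ ())
    byVertex (no _)     (yes refl) _ = cong₂ _xor_ wb bw
    byVertex (no v≢a)   (no v≢b)   h =
      trans (sym (cong₂ _xor_ (rowW v) (switch-outside A b a w c w v≢b v≢a))) h

lessAsymmetricAt-rows : (A : Mat n) {w a b : Fin n} →
  A w a ≡ true → A a w ≡ false → A b w ≡ true → A w b ≡ false →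
  rowSum A b ≤ rowSum A a → LessAsymmetricAt A w
lessAsymmetricAt-rows A wa aw bw wb b≤a with count-surplus (A _) (A _) b≤a bw aw
... | c , ac , bc = switch-lessAsymmetricAt A wa aw bw wb ac bc

-- Balance at w supplies b; whether row a or row b is the longer one decides
-- whether the switch is made in A or in its transpose.
lessAsymmetricAt-out : {A : Mat n} {w a : Fin n} →
  Balanced A → A w a ≡ true → A a w ≡ false → LessAsymmetricAt A w
lessAsymmetricAt-out {A = A} {w} {a} bal wa aw
  with count-surplus (λ u → A u w) (A w) (≤-reflexive (bal w)) wa aw
... | b , bw , wb with ≤-total (rowSum A b) (rowSum A a)
...   | inj₁ b≤a = lessAsymmetricAt-rows A wa aw bw wb b≤a
...   | inj₂ a≤b = lessAsymmetricAt-ᵀ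
          (lessAsymmetricAt-rows (A ᵀ) bw wb wa aw (subst₂ _≤_ (bal a) (bal b) a≤b))

lessAsymmetricAt : {A : Mat n} {w v : Fin n} → Balanced A → A w v ≢ A v w → LessAsymmetricAt A w
lessAsymmetricAt {A = A} {w} {v} bal wv≢vw with A w v in wv | A v w in vw
... | true  | false = lessAsymmetricAt-out bal wv vw
... | false | true  = lessAsymmetricAt-ᵀ (lessAsymmetricAt-out (balanced-ᵀ bal) vw wv)
... | true  | true  = contradiction refl wv≢vw
... | false | false = contradiction refl wv≢vw

symmetrizeAt : (w : Fin n) (A : Mat n) → Balanced A →
  Σ (Mat n) λ S → SameSums S A × SymmetricAt S w
symmetrizeAt w A bal = go A bal (<-wellFounded (mismatch A w))
  where
  go : ∀ A → Balanced A → Acc _<_ (mismatch A w) → Σ (Mat _) λ S → SameSums S A × SymmetricAt S w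
  go A bal (acc smaller) with all? (λ v → A w v ≟ᵇ A v w)
  ... | yes symAt = A , sameSums-refl , symAt
  ... | no ¬symAt with ¬∀⟶∃¬ _ _ (λ v → A w v ≟ᵇ A v w) ¬symAt
  ...   | _ , wv≢vw with lessAsymmetricAt bal wv≢vw
  ...     | B , B∼A , lt with go B (balanced-sameSums B∼A bal) (smaller lt)
  ...       | S , S∼B , symAt = S , sameSums-trans S∼B B∼A , symAt

-- Symmetrizing a balanced matrix

inner : Mat (suc n) → Mat n
inner A u v = A (suc u) (suc v)

rowSum-suc : (A : Mat (suc n)) (u : Fin n) → rowSum A (suc u) ≡ [ A (suc u) zero ] + rowSum (inner A) u
rowSum-suc A u = count-suc (A (suc u))

colSum-suc : (A : Mat (suc n)) (v : Fin n) → colSum A (suc v) ≡ [ A zero (suc v) ] + colSum (inner A) v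
colSum-suc A v = count-suc (λ u → A u (suc v))

balanced-inner : {A : Mat (suc n)} → Balanced A → SymmetricAt A zero → Balanced (inner A)
balanced-inner {A = A} bal symAt u = +-cancelˡ-≡ [ A (suc u) zero ] _ _ (begin
  [ A (suc u) zero ] + rowSum (inner A) u   ≡⟨ rowSum-suc A u ⟨
  rowSum A (suc u)                          ≡⟨ bal (suc u) ⟩
  colSum A (suc u)                          ≡⟨ colSum-suc A u ⟩
  [ A zero (suc u) ] + colSum (inner A) u   ≡⟨ cong ((_+ colSum (inner A) u) ∘ [_]) (symAt (suc u)) ⟩
  [ A (suc u) zero ] + colSum (inner A) u   ∎)

extend : (Fin (suc n) → Bool) → Mat n → Mat (suc n)
extend c T zero    v       = c v
extend c T (suc u) zero    = c (suc u)
extend c T (suc u) (suc v) = T u v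

extend-symmetric : (c : Fin (suc n) → Bool) {T : Mat n} → Symmetric T → Symmetric (extend c T)
extend-symmetric c symT zero    zero    = refl
extend-symmetric c symT zero    (suc v) = refl
extend-symmetric c symT (suc u) zero    = refl
extend-symmetric c symT (suc u) (suc v) = symT u v

symmetrize : (A : Mat n) → Balanced A → Σ (Mat n) λ S → Symmetric S × rowSum S ≗ rowSum A
symmetrize {zero}  A _   = A , (λ ()) , (λ ())
symmetrize {suc n} A bal with symmetrizeAt zero A bal
... | A′ , A′∼A , symAt
  with symmetrize (inner A′) (balanced-inner (balanced-sameSums A′∼A bal) symAt)
...   | T , symT , rowsT = extend (A′ zero) T , extend-symmetric (A′ zero) symT , rows
  where
  rows : rowSum (extend (A′ zero) T) ≗ rowSum A
  rows zero    = proj₁ A′∼A zero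
  rows (suc u) = begin
    rowSum (extend (A′ zero) T) (suc u)      ≡⟨ count-suc (extend (A′ zero) T (suc u)) ⟩
    [ A′ zero (suc u) ] + rowSum T u         ≡⟨ cong₂ _+_ (cong [_] (symAt (suc u))) (rowsT u) ⟩
    [ A′ (suc u) zero ] + rowSum (inner A′) u ≡⟨ rowSum-suc A′ u ⟨
    rowSum A′ (suc u)                        ≡⟨ proj₁ A′∼A (suc u) ⟩
    rowSum A (suc u)                         ∎

↭⇒permutation : ∀ {A : Set} {m k} (f : Fin m → A) (g : Fin k → A) →
  map f (allFin m) ↭ map g (allFin k) → Σ (Permutation m k) λ π → ∀ i → f i ≡ g (π ⟨$⟩ʳ i)
↭⇒permutation {A} {m} {k} f g p = π , lookups
  where
  open SetoidPermutation (setoid A) using (onIndices)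
  open SetoidPermutationProperties (setoid A) using (onIndices-lookup)

  tabulated : tabulate f ↭ tabulate g
  tabulated =
    ↭-trans (↭-reflexive (sym (map-tabulate id f))) (↭-trans p (↭-reflexive (map-tabulate id g)))

  castᶠ : Permutation m (length (tabulate f))
  castᶠ = Perm.cast-id (sym (length-tabulate f))

  castᵍ : Permutation k (length (tabulate g))
  castᵍ = Perm.cast-id (sym (length-tabulate g))

  ρ : Permutation (length (tabulate f)) (length (tabulate g))
  ρ = onIndices (↭⇒↭ₛ tabulated)

  π : Permutation m k
  π = castᶠ ∘ₚ ρ ∘ₚ Perm.flip castᵍ

  lookups : ∀ i → f i ≡ g (π ⟨$⟩ʳ i)
  lookups i = begin
    f i                                             ≡⟨ lookup-tabulate f i ⟨
    lookup (tabulate f) (castᶠ ⟨$⟩ʳ i)               ≡⟨ onIndices-lookup (↭⇒↭ₛ tabulated) _ ⟩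
    lookup (tabulate g) (ρ ⟨$⟩ʳ (castᶠ ⟨$⟩ʳ i))       ≡⟨ cong (lookup (tabulate g)) (Perm.inverseʳ castᵍ) ⟨
    lookup (tabulate g) (castᵍ ⟨$⟩ʳ (π ⟨$⟩ʳ i))       ≡⟨ lookup-tabulate g (π ⟨$⟩ʳ i) ⟩
    g (π ⟨$⟩ʳ i)                                     ∎

bigraphic⇒loopGraphic : ∀ {P} → Bigraphic P P → LoopGraphic P
bigraphic⇒loopGraphic (m , k , B , p₁ , p₂)
  with ↭⇒permutation _ _ (↭-trans p₁ (↭-sym p₂))
... | π , degree≡ with symmetrize (λ u v → B u (π ⟨$⟩ʳ v)) balanced
  where
  balanced : Balanced (λ u v → B u (π ⟨$⟩ʳ v))
  balanced u = trans (count-permute π (B u)) (degree≡ u)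
... | S , symS , rows = m , G , ↭-trans (↭-reflexive degrees) p₁
  where
  G : LGraph m
  G = record { adj = S ; sym = symS }

  degrees : lDegSeq G ≡ degSeq₁ B
  degrees = map-cong (λ u → trans (rows u) (count-permute π (B u))) (allFin m)

loopGraphic⇒mirrorBigraphic : ∀ {P} → LoopGraphic P → MirrorBigraphic P
loopGraphic⇒mirrorBigraphic (n , G , p) =
  n , n , adj , (↔-id _ , symmetric) , p , ↭-trans (↭-reflexive degrees) p
  where
  open LGraph G renaming (sym to symmetric)

  degrees : degSeq₂ adj ≡ degSeq₁ adj
  degrees = map-cong (λ w → count-cong (λ u → symmetric u w)) (allFin n)

mirrorBigraphic⇒bigraphic : ∀ {P} → MirrorBigraphic P → Bigraphic P P
mirrorBigraphic⇒bigraphic (m , k , B , _ , realizes) = m , k , B , realizes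

mainTheorem3 : (P : List ℕ) →
    (LoopGraphic P ⇔ Bigraphic P P) × (Bigraphic P P ⇔ MirrorBigraphic P)
mainTheorem3 P =
  mk⇔ (λ loop → mirrorBigraphic⇒bigraphic (loopGraphic⇒mirrorBigraphic loop))
      bigraphic⇒loopGraphic ,
  mk⇔ (λ big → loopGraphic⇒mirrorBigraphic (bigraphic⇒loopGraphic big)) mirrorBigraphic⇒bigraphic
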